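{- Let $G$ be a bridgeless graph of order $k$, and let $x, z$ be two vertices of $G$ that do not lie in a common block of $G$. Then there exists a strong orientation $\overrightarrow{G}$ of $G$ such that $d_{\overrightarrow{G}}(x,z) \leq k-2$ and $d_{\overrightarrow{G}}(z,x) \leq k-2$.
   Context: All graphs are finite and simple. A graph is bridgeless if it is connected and has no bridge (an edge whose removal disconnects the graph). A block of $G$ is a maximal connected subgraph of $G$ that has no cut vertex. An orientation is strong if the resulting digraph is strongly connected; $d_{\overrightarrow{G}}(u,v)$ denotes the length of a shortest directed path from $u$ to $v$. -}

module Defs where

open import Data.Nat using (ℕ; zero; suc; _≤_; _∸_)
open import Data.Fin using (Fin)
open import Data.Bool using (Bool; true; false; T)
open import Data.Product using (Σ; _×_; _,_; ∃; ∃-syntax)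
open import Data.Sum using (_⊎_)
open import Relation.Nullary using (¬_)
open import Relation.Binary.PropositionalEquality using (_≡_)

record Graph (k : ℕ) : Set where
  field
    adj    : Fin k → Fin k → Bool
    sym    : ∀ u v → adj u v ≡ adj v u
    irrefl : ∀ u → adj u u ≡ false
open Graph public

data Walk {k : ℕ} (R : Fin k → Fin k → Set) : Fin k → Fin k → ℕ → Set where
  []  : ∀ {u} → Walk R u u zero
  _∷_ : ∀ {u v w n} → R u v → Walk R v w n → Walk R u w (suc n)

Reach : {k : ℕ} → (Fin k → Fin k → Set) → Fin k → Fin k → Set
Reach R u v = ∃[ n ] Walk R u v n

Edge : {k : ℕ} → Graph k → Fin k → Fin k → Set
Edge G u v = T (adj G u v)

record Subgraph {k : ℕ} (G : Graph k) : Set₁ where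
  field
    V   : Fin k → Set
    E   : Fin k → Fin k → Set
    E⊆  : ∀ {u v} → E u v → Edge G u v
    Esym : ∀ {u v} → E u v → E v u
    Eend : ∀ {u v} → E u v → V u × V v
open Subgraph public

-- H is connected: every two vertices of H are joined by a walk in H.
-- (The empty graph is not considered connected.)
SubConnected : {k : ℕ} {G : Graph k} → Subgraph G → Set
SubConnected H = (∃[ w ] V H w) × (∀ u v → V H u → V H v → Reach (E H) u v)

-- H has no cut vertex: removing any vertex w of H leaves
-- the remaining graph H - w with all its vertices mutually reachable
-- (for a connected H a cut vertex is exactly a vertex whose removal disconnects H).
NoCutVertex : {k : ℕ} {G : Graph k} → Subgraph G → Set
NoCutVertex H = ∀ w → V H w →
  ∀ u v → V H u → V H v → ¬ u ≡ w → ¬ v ≡ w →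
    Reach (λ a b → E H a b × ¬ a ≡ w × ¬ b ≡ w) u v

_⊑_ : {k : ℕ} {G : Graph k} → Subgraph G → Subgraph G → Set
H ⊑ H' = (∀ u → V H u → V H' u) × (∀ u v → E H u v → E H' u v)

IsBlock : {k : ℕ} {G : Graph k} → Subgraph G → Set₁
IsBlock {G = G} H = SubConnected H × NoCutVertex H ×
  ((H' : Subgraph G) → SubConnected H' → NoCutVertex H' → H ⊑ H' → H' ⊑ H)

InCommonBlock : {k : ℕ} → Graph k → Fin k → Fin k → Set₁
InCommonBlock G x z = Σ (Subgraph G) λ H → IsBlock H × V H x × V H z

Connected : {k : ℕ} → Graph k → Set
Connected G = ∀ u v → Reach (Edge G) u v

SameEdge : {k : ℕ} → Fin k → Fin k → Fin k → Fin k → Set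
SameEdge a b u v = (a ≡ u × b ≡ v) ⊎ (a ≡ v × b ≡ u)

EdgeMinus : {k : ℕ} → Graph k → Fin k → Fin k → Fin k → Fin k → Set
EdgeMinus G u v a b = Edge G a b × ¬ SameEdge a b u v

IsBridge : {k : ℕ} → Graph k → Fin k → Fin k → Set
IsBridge G u v = Edge G u v × ¬ (∀ a b → Reach (EdgeMinus G u v) a b)

Bridgeless : {k : ℕ} → Graph k → Set
Bridgeless G = Connected G × (∀ u v → ¬ IsBridge G u v)

record Orientation {k : ℕ} (G : Graph k) : Set where
  field
    arc     : Fin k → Fin k → Bool
    arc⊆    : ∀ u v → arc u v ≡ true → adj G u v ≡ true
    covers  : ∀ u v → adj G u v ≡ true → arc u v ≡ true ⊎ arc v u ≡ true
    oneway  : ∀ u v → arc u v ≡ true → ¬ arc v u ≡ true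
open Orientation public

Arc : {k : ℕ} {G : Graph k} → Orientation G → Fin k → Fin k → Set
Arc o u v = T (arc o u v)

Strong : {k : ℕ} {G : Graph k} → Orientation G → Set
Strong o = ∀ u v → Reach (Arc o) u v

DistLe : {k : ℕ} {G : Graph k} → Orientation G → Fin k → Fin k → ℕ → Set
DistLe o u v m = ∃[ n ] (Walk (Arc o) u v n × n ≤ m)

{-# OPTIONS --safe #-}

-- Since x and z share no block, they are separated by a single vertex c ≠ x, z. Let Z be the component of
-- z in G − c. The sides X = V ∖ Z and Z ∪ {c} meet only in c and every edge between them ends in c, so
-- each side induces a connected bridgeless graph. An ear decomposition started at x gives a strong
-- orientation of X; from the moment c is reached it keeps track of a walk between x and c, in one of the
-- two directions, that misses some vertex of X, and reversing the orientation if necessary makes it an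
-- x ⇝ c walk. Doing the same on the other side from z and gluing the two orientations at c, the walk
-- x ⇝ c ⇝ z misses a vertex of G, so a shortest x–z path has at most k − 1 vertices, that is length
-- at most k − 2; symmetrically for z ⇝ c ⇝ x.

module Submission where

open import Defs hiding (sym)
open import Data.Nat using (ℕ; zero; suc; _+_; _≤_; _<_; z≤n; s≤s; _∸_)
open import Data.Nat.Properties using (≤-refl; ≤-trans; m≤n⇒m≤1+n; ∸-monoˡ-≤; ∸-monoʳ-<; <-cmp; <-asym; _<?_)
open import Data.Nat.Induction using (<-wellFounded)
open import Induction.WellFounded using (Acc; acc)
open import Data.Fin using (Fin; zero; suc; _≟_; toℕ; fromℕ<)
open import Data.Fin.Properties using (any?; all?; ¬∀⟶∃¬; injective⇒≤; toℕ-fromℕ<; toℕ-injective)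
open import Data.Bool using (T)
open import Data.Bool.Properties using (T-≡)
open import Data.List using (List; []; _∷_; length; lookup)
open import Data.List.Relation.Unary.Any using (here; there)
open import Data.List.Relation.Unary.All using ([]; _∷_) renaming (lookup to lookupᵃ)
open import Data.List.Relation.Unary.All.Properties using (¬Any⇒All¬; All¬⇒¬Any)
open import Data.List.Relation.Unary.Unique.Propositional using (Unique; _∷_; [])
open import Data.List.Membership.Propositional using (_∈_; _∉_)
open import Data.List.Membership.Propositional.Properties using (∈-lookup)
open import Data.List.Relation.Binary.Subset.Propositional using (_⊆_)
open import Data.Product using (Σ; _×_; _,_; ∃-syntax; proj₁; proj₂)
open import Data.Sum using (_⊎_; inj₁; inj₂; [_,_]′) renaming (map to ⊎-map; swap to ⊎-swap)
open import Data.Empty using (⊥; ⊥-elim)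
open import Function using (_∘_; id; flip; Equivalence)
open import Relation.Nullary using (¬_; Dec; yes; no)
open import Relation.Nullary.Decidable
  using (_×-dec_; _⊎-dec_; _→-dec_; ¬?; T?; isYes; toWitness; fromWitness; decidable-stable; ¬¬-excluded-middle)
open import Relation.Binary using (Decidable; tri<; tri≈; tri>)
open import Relation.Binary.PropositionalEquality using (_≡_; _≢_; refl; sym; trans; cong; subst)

-- Walks and paths

lookup-injective : ∀ {A : Set} {xs : List A} → Unique xs → ∀ {i j} → lookup xs i ≡ lookup xs j → i ≡ j
lookup-injective (_   ∷ _) {zero}  {zero}  _  = refl
lookup-injective (x∉ ∷ _) {zero}  {suc j} eq = ⊥-elim (lookupᵃ x∉ (∈-lookup j) eq)
lookup-injective (x∉ ∷ _) {suc i} {zero}  eq = ⊥-elim (lookupᵃ x∉ (∈-lookup i) (sym eq))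
lookup-injective (_   ∷ u) {suc i} {suc j} eq = cong suc (lookup-injective u eq)

unique⇒length≤ : ∀ {k} {xs : List (Fin k)} → Unique xs → length xs ≤ k
unique⇒length≤ u = injective⇒≤ (lookup-injective u)

module _ {k : ℕ} where

  open import Data.List.Membership.DecPropositional (_≟_ {k}) using (_∈?_)

  private
    variable
      a b c : Fin k
      n m : ℕ
      R R′ : Fin k → Fin k → Set

  vertices : Walk R a b n → List (Fin k)
  vertices {a = a} []      = a ∷ []
  vertices {a = a} (_ ∷ W) = a ∷ vertices W

  length-vertices : (W : Walk R a b n) → length (vertices W) ≡ suc n
  length-vertices []      = refl
  length-vertices (_ ∷ W) = cong suc (length-vertices W)

  source∈ : (W : Walk R a b n) → a ∈ vertices W
  source∈ []      = here refl
  source∈ (_ ∷ _) = here refl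

  target∈ : (W : Walk R a b n) → b ∈ vertices W
  target∈ []      = here refl
  target∈ (_ ∷ W) = there (target∈ W)

  infixr 5 _++ʷ_
  _++ʷ_ : Walk R a b n → Walk R b c m → Walk R a c (n + m)
  []      ++ʷ V = V
  (e ∷ W) ++ʷ V = e ∷ (W ++ʷ V)

  ∉-++ʷ : ∀ {v} (W : Walk R a b n) (V : Walk R b c m) →
          v ∉ vertices W → v ∉ vertices V → v ∉ vertices (W ++ʷ V)
  ∉-++ʷ []      V v∉W v∉V v∈      = v∉V v∈
  ∉-++ʷ (e ∷ W) V v∉W v∉V (here eq) = v∉W (here eq)
  ∉-++ʷ (e ∷ W) V v∉W v∉V (there v∈) = ∉-++ʷ W V (v∉W ∘ there) v∉V v∈

  mapʷ : (∀ {p q} → R p q → R′ p q) → Walk R a b n → Walk R′ a b n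
  mapʷ f []      = []
  mapʷ f (e ∷ W) = f e ∷ mapʷ f W

  vertices-mapʷ : (f : ∀ {p q} → R p q → R′ p q) (W : Walk R a b n) → vertices (mapʷ f W) ≡ vertices W
  vertices-mapʷ f []      = refl
  vertices-mapʷ f (e ∷ W) = cong (_ ∷_) (vertices-mapʷ f W)

  ∉-mapʷ : ∀ {v} (f : ∀ {p q} → R p q → R′ p q) (W : Walk R a b n) →
           v ∉ vertices W → v ∉ vertices (mapʷ f W)
  ∉-mapʷ {v = v} f W v∉ = v∉ ∘ subst (v ∈_) (vertices-mapʷ f W)

  _∷ʳ_ : Walk R a b n → R b c → Walk R a c (suc n)
  []      ∷ʳ e = e ∷ []
  (d ∷ W) ∷ʳ e = d ∷ (W ∷ʳ e)

  ∈-∷ʳ⁻ : ∀ {v} (W : Walk R a b n) (e : R b c) → v ∈ vertices (W ∷ʳ e) → v ∈ vertices W ⊎ v ≡ c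
  ∈-∷ʳ⁻ []      e (here eq)         = inj₁ (here eq)
  ∈-∷ʳ⁻ []      e (there (here eq)) = inj₂ eq
  ∈-∷ʳ⁻ (d ∷ W) e (here eq)         = inj₁ (here eq)
  ∈-∷ʳ⁻ (d ∷ W) e (there v∈) with ∈-∷ʳ⁻ W e v∈
  ... | inj₁ v∈W = inj₁ (there v∈W)
  ... | inj₂ v≡c = inj₂ v≡c

  ∉-∷ʳ : ∀ {v} (W : Walk R a b n) (e : R b c) → v ∉ vertices W → v ≢ c → v ∉ vertices (W ∷ʳ e)
  ∉-∷ʳ W e v∉ v≢c v∈ = [ v∉ , v≢c ]′ (∈-∷ʳ⁻ W e v∈)

  reverseʷ : (∀ {p q} → R p q → R′ q p) → Walk R a b n → Walk R′ b a n
  reverseʷ f []      = []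
  reverseʷ f (e ∷ W) = reverseʷ f W ∷ʳ f e

  ∉-reverseʷ : ∀ {v} (f : ∀ {p q} → R p q → R′ q p) (W : Walk R a b n) →
               v ∉ vertices W → v ∉ vertices (reverseʷ f W)
  ∉-reverseʷ f []      v∉ = v∉
  ∉-reverseʷ f (e ∷ W) v∉ v∈ with ∈-∷ʳ⁻ (reverseʷ f W) (f e) v∈
  ... | inj₁ v∈W = ∉-reverseʷ f W (v∉ ∘ there) v∈W
  ... | inj₂ refl = v∉ (here refl)

  reach-trans : Reach R a b → Reach R b c → Reach R a c
  reach-trans (n , W) (m , V) = n + m , W ++ʷ V

  reach-map : (∀ {p q} → R p q → R′ p q) → Reach R a b → Reach R′ a b
  reach-map f (n , W) = n , mapʷ f W

  reach-reverse : (∀ {p q} → R p q → R′ q p) → Reach R a b → Reach R′ b a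
  reach-reverse f (n , W) = n , reverseʷ f W

  WalkMissing : (Fin k → Fin k → Set) → Fin k → Fin k → Fin k → Set
  WalkMissing R v a b = ∃[ n ] Σ (Walk R a b n) λ W → v ∉ vertices W

  allVertices : ∀ {P : Fin k → Set} → (∀ {p q} → R p q → P q) → P a →
                (W : Walk R a b n) → ∀ {v} → v ∈ vertices W → P v
  allVertices h pa []      (here refl) = pa
  allVertices h pa (e ∷ W) (here refl) = pa
  allVertices h pa (e ∷ W) (there v∈) = allVertices h (h e) W v∈

  record Split (W : Walk R a b n) (v : Fin k) : Set where
    field
      {ℓ₁ ℓ₂}  : ℕ
      prefix   : Walk R a v ℓ₁
      suffix   : Walk R v b ℓ₂
      suffix-⊆ : vertices suffix ⊆ vertices W
      suffix-unique : Unique (vertices W) → Unique (vertices suffix)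
      suffix-≤ : ℓ₂ ≤ n

  splitAtSource : (W : Walk R a b n) → Split W a
  splitAtSource W = record { prefix = [] ; suffix = W ; suffix-⊆ = id ; suffix-unique = id ; suffix-≤ = ≤-refl }

  split : (W : Walk R a b n) → ∀ {v} → v ∈ vertices W → Split W v
  split []      (here refl) = splitAtSource []
  split (e ∷ W) (here refl) = splitAtSource (e ∷ W)
  split (e ∷ W) (there v∈) = record
    { prefix = e ∷ prefix ; suffix = suffix ; suffix-⊆ = there ∘ suffix-⊆
    ; suffix-unique = λ { (_ ∷ u) → suffix-unique u } ; suffix-≤ = m≤n⇒m≤1+n suffix-≤ }
    where open Split (split W v∈)

  record Shortcut (W : Walk R a b n) : Set where
    field
      {ℓ}    : ℕ
      path   : Walk R a b ℓ
      path-⊆ : vertices path ⊆ vertices W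
      path-unique : Unique (vertices path)
      path-≤ : ℓ ≤ n

  shortcut : (W : Walk R a b n) → Shortcut W
  shortcut [] = record { path = [] ; path-⊆ = λ v∈ → v∈ ; path-unique = [] ∷ [] ; path-≤ = z≤n }
  shortcut {a = a} (e ∷ W) with shortcut W
  ... | record { path = P ; path-⊆ = P⊆ ; path-unique = uP ; path-≤ = P≤ } with a ∈? vertices P
  ...   | yes a∈P = record
          { path = suffix ; path-⊆ = there ∘ P⊆ ∘ suffix-⊆ ; path-unique = suffix-unique uP
          ; path-≤ = ≤-trans suffix-≤ (m≤n⇒m≤1+n P≤) }
    where open Split (split P a∈P)
  ...   | no a∉P = record
          { path = e ∷ P ; path-⊆ = λ { (here eq) → here eq ; (there v∈) → there (P⊆ v∈) }
          ; path-unique = ¬Any⇒All¬ _ a∉P ∷ uP ; path-≤ = s≤s P≤ }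

  path-length< : (W : Walk R a b n) → Unique (vertices W) → n < k
  path-length< W u = subst (_≤ k) (length-vertices W) (unique⇒length≤ u)

  path-missing-length≤ : ∀ {v} (W : Walk R a b n) → Unique (vertices W) → v ∉ vertices W → n ≤ k ∸ 2
  path-missing-length≤ W u v∉ =
    ∸-monoˡ-≤ 2 (subst (_≤ k) (cong suc (length-vertices W)) (unique⇒length≤ (¬Any⇒All¬ _ v∉ ∷ u)))

  walk? : Decidable R → ∀ n → Decidable (λ a b → Walk R a b n)
  walk? R? zero    a b with a ≟ b
  ... | yes refl = yes []
  ... | no a≢b   = no λ { [] → a≢b refl }
  walk? R? (suc n) a b with any? (λ c → R? a c ×-dec walk? R? n c b)
  ... | yes (c , e , W) = yes (e ∷ W)
  ... | no ∄c           = no λ { (e ∷ W) → ∄c (_ , e , W) }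

  reach? : {R : Fin k → Fin k → Set} → Decidable R → Decidable (Reach R)
  reach? {R} R? a b with any? (λ (i : Fin k) → walk? R? (toℕ i) a b)
  ... | yes (i , W) = yes (toℕ i , W)
  ... | no ∄i = no λ (n , W) → let open Shortcut (shortcut W) in
      ∄i (fromℕ< (path-length< path path-unique) , subst (λ m → Walk R a b m) (sym (toℕ-fromℕ< _)) path)

-- Walks confined to a vertex set

module _ {k : ℕ} where

  private
    variable
      a b : Fin k
      n : ℕ

  Within : (Fin k → Fin k → Set) → (Fin k → Set) → Fin k → Fin k → Set
  Within R P p q = R p q × P p × P q

  LeavingOutside : (Fin k → Fin k → Set) → (Fin k → Set) → Fin k → Fin k → Set
  LeavingOutside R P p q = R p q × ¬ P p

  ExcursionsReturn : (Fin k → Fin k → Set) → (Fin k → Set) → Set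
  ExcursionsReturn R P = ∀ {p q r m} → R p q → P p → ¬ P q → Walk (LeavingOutside R P) q r m → P r → p ≡ r

  module _ {R : Fin k → Fin k → Set} {P : Fin k → Set} (P? : ∀ v → Dec (P v)) (return : ExcursionsReturn R P) where

    private
      -- outside: the walk left P along p → q₀ and has not come back yet; it must re-enter P at p.
      data Position (a q : Fin k) : Set where
        inside  : P q → Reach (Within R P) a q → Position a q
        outside : ∀ {p q₀ m} → P p → Reach (Within R P) a p → R p q₀ → ¬ P q₀ →
                  Walk (LeavingOutside R P) q₀ q m → ¬ P q → Position a q

      step : ∀ {a q q′} → Position a q → R q q′ → Position a q′
      step {q′ = q′} (inside pq r) e with P? q′
      ... | yes pq′ = inside pq′ (reach-trans r (1 , (e , pq , pq′) ∷ []))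
      ... | no ¬pq′ = outside pq r e ¬pq′ [] ¬pq′
      step {q′ = q′} (outside pp r e₀ ¬pq₀ W ¬pq) e with P? q′
      ... | no ¬pq′ = outside pp r e₀ ¬pq₀ (W ∷ʳ (e , ¬pq)) ¬pq′
      ... | yes pq′ with return e₀ pp ¬pq₀ (W ∷ʳ (e , ¬pq)) pq′
      ...   | refl = inside pq′ r

      finish : ∀ {a q b} → Position a q → Walk R q b n → P b → Reach (Within R P) a b
      finish (inside _ r)            []      pb = r
      finish (outside _ _ _ _ _ ¬pq) []      pb = ⊥-elim (¬pq pb)
      finish pos                     (e ∷ W) pb = finish (step pos e) W pb

    stayWithin : Walk R a b n → P a → P b → Reach (Within R P) a b
    stayWithin W pa pb = finish (inside pa (0 , [])) W pb

module _ {k : ℕ} where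

  private
    variable
      a b c v : Fin k
      n : ℕ
      R R′ : Fin k → Fin k → Set

  data _∋_⟶_ {R : Fin k → Fin k → Set} : ∀ {a b n} → Walk R a b n → Fin k → Fin k → Set where
    here  : ∀ {a v b n} {e : R a v} {W : Walk R v b n} → (e ∷ W) ∋ a ⟶ v
    there : ∀ {a v b n p q} {e : R a v} {W : Walk R v b n} → W ∋ p ⟶ q → (e ∷ W) ∋ p ⟶ q

  step? : (W : Walk R a b n) → Decidable (W ∋_⟶_)
  step? []                  p q = no λ ()
  step? (_∷_ {u} {v} e W) p q with u ≟ p | v ≟ q | step? W p q
  ... | yes refl | yes refl | _       = yes here
  ... | _        | _        | yes s   = yes (there s)
  ... | no u≢p   | _        | no ¬s   = no λ { here → u≢p refl ; (there s) → ¬s s }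
  ... | yes _    | no v≢q   | no ¬s   = no λ { here → v≢q refl ; (there s) → ¬s s }

  step-rel : {W : Walk R a b n} → ∀ {p q} → W ∋ p ⟶ q → R p q
  step-rel {W = e ∷ _} here      = e
  step-rel           (there s) = step-rel s

  step-vertices : {W : Walk R a b n} → ∀ {p q} → W ∋ p ⟶ q → p ∈ vertices W × q ∈ vertices W
  step-vertices {W = _ ∷ W} here      = here refl , there (source∈ W)
  step-vertices           (there s) = let p∈ , q∈ = step-vertices s in there p∈ , there q∈

  step-asym : {W : Walk R a b n} → Unique (vertices W) → ∀ {p q} → W ∋ p ⟶ q → W ∋ q ⟶ p → ⊥
  step-asym {W = _ ∷ W} (a∉ ∷ _) here      here       = All¬⇒¬Any a∉ (source∈ W)
  step-asym             (a∉ ∷ _) here      (there s)  = All¬⇒¬Any a∉ (proj₂ (step-vertices s))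
  step-asym             (a∉ ∷ _) (there s) here       = All¬⇒¬Any a∉ (proj₂ (step-vertices s))
  step-asym             (_ ∷ u)  (there s) (there s′) = step-asym u s s′

  steps : (W : Walk R a b n) → Walk (W ∋_⟶_) a b n
  steps []      = []
  steps (e ∷ W) = here ∷ mapʷ there (steps W)

  vertices-steps : (W : Walk R a b n) → vertices (steps W) ≡ vertices W
  vertices-steps []      = refl
  vertices-steps (e ∷ W) = cong (_ ∷_) (trans (vertices-mapʷ there (steps W)) (vertices-steps W))

  firstStep : ∀ {a b n} (W : Walk R a b n) → a ≢ b → ∃[ q ] W ∋ a ⟶ q
  firstStep []      a≢b = ⊥-elim (a≢b refl)
  firstStep (e ∷ W) _   = _ , here

  stepsFrom : ∀ {a b n v} (W : Walk R a b n) → Unique (vertices W) → v ∈ vertices W → v ≢ a →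
              WalkMissing (W ∋_⟶_) a v b
  stepsFrom []      _        (here v≡a)  v≢a = ⊥-elim (v≢a v≡a)
  stepsFrom (e ∷ W) _        (here v≡a)  v≢a = ⊥-elim (v≢a v≡a)
  stepsFrom (e ∷ W) (a∉ ∷ _) (there v∈) v≢a =
    _ , mapʷ there suffix , ∉-mapʷ there suffix (All¬⇒¬Any a∉ ∘ subst (_ ∈_) (vertices-steps W) ∘ suffix-⊆)
    where open Split (split (steps W) (subst (_ ∈_) (sym (vertices-steps W)) v∈))

  firstHit : ∀ {P : Fin k → Set} → (∀ v → Dec (P v)) → Walk R a b n → P b →
             ∃[ t ] P t × Reach (LeavingOutside R P) a t
  firstHit {a = a} P? W pb with P? a
  firstHit P? []      pb | no ¬pa = ⊥-elim (¬pa pb)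
  firstHit P? (e ∷ W) pb | no ¬pa = let t , pt , (n , V) = firstHit P? W pb in t , pt , suc n , (e , ¬pa) ∷ V
  ... | yes pa = _ , pa , 0 , []

  exit : ∀ {S : Fin k → Set} → (∀ v → Dec (S v)) → Walk R a b n → S a → ¬ S b →
         ∃[ u ] ∃[ w ] R u w × S u × ¬ S w
  exit S? []                    sa ¬sb = ⊥-elim (¬sb sa)
  exit S? (_∷_ {v = v} e W) sa ¬sb with S? v
  ... | yes sv = exit S? W sv ¬sb
  ... | no ¬sv = _ , _ , e , sa , ¬sv

  firstOf : ∀ {a b} u → u ≢ b → Walk R a b n → WalkMissing R b a u ⊎ WalkMissing R u a b
  firstOf {a = a} {b = b} u u≢b W with a ≟ u | a ≟ b
  ... | yes refl | _        = inj₁ (0 , [] , λ { (here b≡a) → u≢b (sym b≡a) })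
  ... | no a≢u   | yes refl = inj₂ (0 , [] , λ { (here u≡a) → a≢u (sym u≡a) })
  firstOf u u≢b []      | no a≢u | no a≢b = ⊥-elim (a≢b refl)
  firstOf u u≢b (e ∷ W) | no a≢u | no a≢b with firstOf u u≢b W
  ... | inj₁ (n , V , b∉) = inj₁ (suc n , e ∷ V , λ { (here b≡a) → a≢b (sym b≡a) ; (there b∈) → b∉ b∈ })
  ... | inj₂ (n , V , u∉) = inj₂ (suc n , e ∷ V , λ { (here u≡a) → a≢u (sym u≡a) ; (there u∈) → u∉ u∈ })

-- Separating vertices and blocks

module _ {k : ℕ} (G : Graph k) where

  private
    variable
      a b c : Fin k
      n : ℕ

  edge? : Decidable (Edge G)
  edge? a b = T? (adj G a b)

  edge-sym : Edge G a b → Edge G b a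
  edge-sym {a} {b} = subst T (Graph.sym G a b)

  edge-irrefl : Edge G a b → a ≢ b
  edge-irrefl {a} e refl = subst T (irrefl G a) e

  Avoiding : Fin k → Fin k → Fin k → Set
  Avoiding c = Within (Edge G) (_≢ c)

  avoiding? : ∀ c → Decidable (Avoiding c)
  avoiding? c a b = edge? a b ×-dec (¬? (a ≟ c) ×-dec ¬? (b ≟ c))

  avoiding-sym : Avoiding c a b → Avoiding c b a
  avoiding-sym (e , a≢c , b≢c) = edge-sym e , b≢c , a≢c

  avoiding-outside : ∀ {R P} → (∀ {p q} → R p q → Edge G p q) → P c →
                     Walk (LeavingOutside R P) a b n → b ≢ c → Walk (Avoiding c) a b n
  avoiding-outside toE pc [] b≢c = []
  avoiding-outside {P = P} toE pc ((e , ¬pa) ∷ W) b≢c =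
    (toE e , outside≢ ¬pa , source≢ W) ∷ avoiding-outside toE pc W b≢c
    where
      outside≢ : ∀ {v} → ¬ P v → v ≢ _
      outside≢ ¬pv refl = ¬pv pc
      source≢ : ∀ {a n} → Walk (LeavingOutside _ P) a _ n → a ≢ _
      source≢ []             = b≢c
      source≢ ((_ , ¬pa) ∷ _) = outside≢ ¬pa

  Inseparable : Fin k → Fin k → Set
  Inseparable u v = ∀ c → c ≢ u → c ≢ v → Reach (Avoiding c) u v

  inseparable? : Decidable Inseparable
  inseparable? u v = all? λ c → ¬? (c ≟ u) →-dec (¬? (c ≟ v) →-dec reach? (avoiding? c) u v)

  inseparable-refl : ∀ u → Inseparable u u
  inseparable-refl u c _ _ = 0 , []

  inseparable-sym : Inseparable a b → Inseparable b a
  inseparable-sym ab c c≢b c≢a = reach-reverse avoiding-sym (ab c c≢a c≢b)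

  adjacent-inseparable : Edge G a b → Inseparable a b
  adjacent-inseparable e c c≢a c≢b = 1 , (e , c≢a ∘ sym , c≢b ∘ sym) ∷ []

  separator : ∀ {x z} → ¬ Inseparable x z → ∃[ c ] c ≢ x × c ≢ z × ¬ Reach (Avoiding c) x z
  separator {x} {z} ¬xz
    with ¬∀⟶∃¬ k _ (λ c → ¬? (c ≟ x) →-dec (¬? (c ≟ z) →-dec reach? (avoiding? c) x z)) ¬xz
  ... | c , ¬sep with c ≟ x | c ≟ z
  ...   | yes refl | _        = ⊥-elim (¬sep λ c≢x → ⊥-elim (c≢x refl))
  ...   | no c≢x   | yes refl = ⊥-elim (¬sep λ _ c≢z → ⊥-elim (c≢z refl))
  ...   | no c≢x   | no c≢z   = c , c≢x , c≢z , λ r → ¬sep λ _ _ → r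

  noCutVertex⇒inseparable : (H : Subgraph G) → SubConnected H → NoCutVertex H →
                            ∀ {u v} → V H u → V H v → Inseparable u v
  noCutVertex⇒inseparable H connH noCutH {u} {v} hu hv c c≢u c≢v =
    decidable-stable (reach? (avoiding? c) u v) λ ¬r → ¬¬-excluded-middle λ where
      (yes hc) → ¬r (reach-map (λ (e , p≢c , q≢c) → E⊆ H e , p≢c , q≢c)
                              (noCutH c hc u v hu hv (c≢u ∘ sym) (c≢v ∘ sym)))
      (no ¬hc) → ¬r (reach-map (λ e → E⊆ H e , (λ { refl → ¬hc (proj₁ (Eend H e)) })
                                              , (λ { refl → ¬hc (proj₂ (Eend H e)) }))
                              (proj₂ connH u v hu hv))

  module _ (conn : Connected G) {x y : Fin k} (x≢y : x ≢ y) (xy : Inseparable x y) where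

    private
      InB : Fin k → Set
      InB u = Inseparable u x × Inseparable u y

      inB? : ∀ u → Dec (InB u)
      inB? u = inseparable? u x ×-dec inseparable? u y

      x∈B : InB x
      x∈B = inseparable-refl x , xy

      y∈B : InB y
      y∈B = inseparable-sym xy , inseparable-refl y

      B : Subgraph G
      B = record
        { V = InB ; E = Within (Edge G) InB ; E⊆ = proj₁
        ; Esym = λ (e , pa , pb) → edge-sym e , pb , pa ; Eend = proj₂ }

      excursions-return : ∀ {R} → (∀ {p q} → R p q → Edge G p q) → ExcursionsReturn R InB
      excursions-return toE {p} {q} {r} e pp ¬pq W pr with p ≟ r
      ... | yes p≡r = p≡r
      ... | no p≢r  = ⊥-elim (¬pq (back (proj₁ pp) (proj₁ pr) , back (proj₂ pp) (proj₂ pr)))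
        where
          back : ∀ {v} → Inseparable p v → Inseparable r v → Inseparable q v
          back pv rv c c≢q c≢v with c ≟ p
          ... | yes refl = reach-trans (_ , avoiding-outside toE pp W (p≢r ∘ sym)) (rv c p≢r c≢v)
          ... | no c≢p   = reach-trans (adjacent-inseparable (edge-sym (toE e)) c c≢q c≢p) (pv c c≢p c≢v)

      connected : SubConnected B
      connected = (x , x∈B) , λ u v pu pv → stayWithin inB? (excursions-return id) (proj₂ (conn u v)) pu pv

      noCutVertex : NoCutVertex B
      noCutVertex w _ u v pu pv u≢w v≢w =
        reach-map (λ ((e , p≢w , q≢w) , pp , pq) → (e , pp , pq) , p≢w , q≢w)
                  (stayWithin inB? (excursions-return proj₁) (proj₂ avoidingW) pu pv)
        where
          via : ∀ {h} → w ≢ h → (∀ {s} → InB s → Inseparable s h) → Reach (Avoiding w) u v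
          via w≢h toH = reach-trans (toH pu w (u≢w ∘ sym) w≢h)
                                    (inseparable-sym (toH pv) w w≢h (v≢w ∘ sym))
          avoidingW : Reach (Avoiding w) u v
          avoidingW with w ≟ x
          ... | no w≢x   = via w≢x proj₁
          ... | yes refl = via x≢y proj₂

      maximal : (H : Subgraph G) → SubConnected H → NoCutVertex H → B ⊑ H → H ⊑ B
      maximal H connH noCutH (B⊆H , _) =
        H⊆B , λ u v e → E⊆ H e , H⊆B u (proj₁ (Eend H e)) , H⊆B v (proj₂ (Eend H e))
        where
          H⊆B : ∀ u → V H u → InB u
          H⊆B u hu = noCutVertex⇒inseparable H connH noCutH hu (B⊆H x x∈B)
                   , noCutVertex⇒inseparable H connH noCutH hu (B⊆H y y∈B)

    commonBlock : InCommonBlock G x y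
    commonBlock = B , (connected , noCutVertex , maximal) , x∈B , y∈B

  singletonBlock : ∀ x → (∀ v → v ≡ x) → InCommonBlock G x x
  singletonBlock x only = H , (connected , noCutVertex , maximal) , refl , refl
    where
      H : Subgraph G
      H = record { V = _≡ x ; E = λ _ _ → ⊥ ; E⊆ = λ () ; Esym = λ () ; Eend = λ () }
      connected : SubConnected H
      connected = (x , refl) , λ { _ _ refl refl → 0 , [] }
      noCutVertex : NoCutVertex H
      noCutVertex w refl u v refl _ u≢w _ = ⊥-elim (u≢w refl)
      maximal : (H′ : Subgraph G) → SubConnected H′ → NoCutVertex H′ → H ⊑ H′ → H′ ⊑ H
      maximal H′ _ _ _ =
        (λ u _ → only u) , λ u v e → ⊥-elim (edge-irrefl (E⊆ H′ e) (trans (only u) (sym (only v))))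

  inseparable⇒inCommonBlock : Connected G → ∀ {x z} → Inseparable x z → InCommonBlock G x z
  inseparable⇒inCommonBlock conn {x} {z} xz with x ≟ z
  ... | no x≢z   = commonBlock conn x≢z xz
  ... | yes refl with any? (λ v → ¬? (v ≟ x))
  ...   | no ∄v        = singletonBlock x λ v → decidable-stable (v ≟ x) λ v≢x → ∄v (v , v≢x)
  ...   | yes (v , v≢x) = viaNeighbour (proj₂ (conn x v))
    where
      viaNeighbour : ∀ {n} → Walk (Edge G) x v n → InCommonBlock G x x
      viaNeighbour []      = ⊥-elim (v≢x refl)
      viaNeighbour (e ∷ _) with commonBlock conn (edge-irrefl e) (adjacent-inseparable e)
      ... | B , isB , xB , _ = B , isB , xB , xB

-- Strong orientations by ear decomposition

count : ∀ {n} {P : Fin n → Set} → (∀ i → Dec (P i)) → ℕ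
count {zero}  P? = 0
count {suc n} P? with P? zero
... | yes _ = suc (count (P? ∘ suc))
... | no _  = count (P? ∘ suc)

count≤ : ∀ {n} {P : Fin n → Set} (P? : ∀ i → Dec (P i)) → count P? ≤ n
count≤ {zero}  P? = z≤n
count≤ {suc n} P? with P? zero
... | yes _ = s≤s (count≤ (P? ∘ suc))
... | no _  = m≤n⇒m≤1+n (count≤ (P? ∘ suc))

count-mono : ∀ {n} {P Q : Fin n → Set} (P? : ∀ i → Dec (P i)) (Q? : ∀ i → Dec (Q i)) →
             (∀ {i} → P i → Q i) → count P? ≤ count Q?
count-mono {zero}  P? Q? P⊆Q = z≤n
count-mono {suc n} P? Q? P⊆Q with P? zero | Q? zero
... | yes _  | yes _  = s≤s (count-mono (P? ∘ suc) (Q? ∘ suc) P⊆Q)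
... | no _   | yes _  = m≤n⇒m≤1+n (count-mono (P? ∘ suc) (Q? ∘ suc) P⊆Q)
... | no _   | no _   = count-mono (P? ∘ suc) (Q? ∘ suc) P⊆Q
... | yes p₀ | no ¬q₀ = ⊥-elim (¬q₀ (P⊆Q p₀))

count-mono-< : ∀ {n} {P Q : Fin n → Set} (P? : ∀ i → Dec (P i)) (Q? : ∀ i → Dec (Q i)) →
               (∀ {i} → P i → Q i) → ∀ j → Q j → ¬ P j → count P? < count Q?
count-mono-< {suc n} P? Q? P⊆Q zero qj ¬pj with P? zero | Q? zero
... | yes p₀ | _      = ⊥-elim (¬pj p₀)
... | no _   | yes _  = s≤s (count-mono (P? ∘ suc) (Q? ∘ suc) P⊆Q)
... | no _   | no ¬q₀ = ⊥-elim (¬q₀ qj)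
count-mono-< {suc n} P? Q? P⊆Q (suc j) qj ¬pj with P? zero | Q? zero
... | yes _  | yes _  = s≤s (count-mono-< (P? ∘ suc) (Q? ∘ suc) P⊆Q j qj ¬pj)
... | no _   | yes _  = m≤n⇒m≤1+n (count-mono-< (P? ∘ suc) (Q? ∘ suc) P⊆Q j qj ¬pj)
... | no _   | no _   = count-mono-< (P? ∘ suc) (Q? ∘ suc) P⊆Q j qj ¬pj
... | yes p₀ | no ¬q₀ = ⊥-elim (¬q₀ (P⊆Q p₀))

module _ {k : ℕ} where

  MissingWalk : (Fin k → Fin k → Set) → (Fin k → Set) → Fin k → Fin k → Set
  MissingWalk R P a b = ∃[ w ] P w × WalkMissing R w a b

  missingWalk-map : ∀ {R R′ P a b} → (∀ {p q} → R p q → R′ p q) → MissingWalk R P a b → MissingWalk R′ P a b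
  missingWalk-map f (w , pw , n , W , w∉) = w , pw , n , mapʷ f W , ∉-mapʷ f W w∉

  missingWalk-reverse : ∀ {R R′ P a b} → (∀ {p q} → R p q → R′ q p) →
                        MissingWalk R P a b → MissingWalk R′ P b a
  missingWalk-reverse f (w , pw , n , W , w∉) = w , pw , n , reverseʷ f W , ∉-reverseʷ f W w∉

  record StrongOrientationOn (G : Graph k) (P : Fin k → Set) : Set₁ where
    field
      _↝_      : Fin k → Fin k → Set
      ↝?       : Decidable _↝_
      ↝⊆edge   : ∀ {p q} → p ↝ q → Within (Edge G) P p q
      ↝-total  : ∀ {p q} → Within (Edge G) P p q → p ↝ q ⊎ q ↝ p
      ↝-asym   : ∀ {p q} → p ↝ q → q ↝ p → ⊥
      ↝-strong : ∀ {p q} → P p → P q → Reach _↝_ p q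

  reverseOrientation : ∀ {G P} → StrongOrientationOn G P → StrongOrientationOn G P
  reverseOrientation {G} o = record
    { _↝_ = λ p q → q ↝ p ; ↝? = λ p q → ↝? q p
    ; ↝⊆edge = λ a → let e , pq , pp = ↝⊆edge a in edge-sym G e , pp , pq
    ; ↝-total = ⊎-swap ∘ ↝-total
    ; ↝-asym = λ a a′ → ↝-asym a′ a
    ; ↝-strong = λ pp pq → reach-reverse id (↝-strong pq pp) }
    where open StrongOrientationOn o

module EarDecomposition {k : ℕ} (G : Graph k) {P : Fin k → Set} (P? : ∀ v → Dec (P v))
  (connected : ∀ {u v} → P u → P v → Reach (Within (Edge G) P) u v)
  (bridgeless : ∀ {u w} → Within (Edge G) P u w → Reach (Within (EdgeMinus G u w) P) w u)
  {a b : Fin k} (a∈P : P a) (b∈P : P b) (a≢b : a ≢ b) where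

  open import Data.List.Membership.DecPropositional (_≟_ {k}) using (_∈?_)

  Track : (Fin k → Fin k → Set) → Set
  Track D = MissingWalk D P a b ⊎ MissingWalk D P b a

  track-map : ∀ {D D′} → (∀ {p q} → D p q → D′ p q) → Track D → Track D′
  track-map f = [ inj₁ ∘ missingWalk-map f , inj₂ ∘ missingWalk-map f ]′

  record PartialOrientation : Set₁ where
    field
      S        : Fin k → Set
      S?       : ∀ v → Dec (S v)
      S⊆P      : ∀ {v} → S v → P v
      a∈S      : S a
      D        : Fin k → Fin k → Set
      D?       : Decidable D
      D⊆       : ∀ {p q} → D p q → Within (Edge G) S p q
      D-asym   : ∀ {p q} → D p q → D q p → ⊥
      D-strong : ∀ {p q} → S p → S q → Reach D p q
      track    : S b → Track D

  open PartialOrientation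

  reversePartial : PartialOrientation → PartialOrientation
  reversePartial st = record
    { S = S st ; S? = S? st ; S⊆P = S⊆P st ; a∈S = a∈S st
    ; D = λ p q → D st q p ; D? = λ p q → D? st q p
    ; D⊆ = λ d → let e , sq , sp = D⊆ st d in edge-sym G e , sp , sq
    ; D-asym = λ d d′ → D-asym st d′ d
    ; D-strong = λ sp sq → reach-reverse id (D-strong st sq sp)
    ; track = [ inj₂ ∘ missingWalk-reverse id , inj₁ ∘ missingWalk-reverse id ]′ ∘ track st }

  initial : PartialOrientation
  initial = record
    { S = _≡ a ; S? = _≟ a ; S⊆P = λ { refl → a∈P } ; a∈S = refl
    ; D = λ _ _ → ⊥ ; D? = λ _ _ → no id ; D⊆ = λ () ; D-asym = λ ()
    ; D-strong = λ { refl refl → 0 , [] } ; track = λ b≡a → ⊥-elim (a≢b (sym b≡a)) }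

  record Ear (S : Fin k → Set) : Set where
    field
      {u w t}     : Fin k
      {ℓ}         : ℕ
      uw          : Within (Edge G) P u w
      u∈S         : S u
      w∉S         : ¬ S w
      t∈S         : S t
      path        : Walk (LeavingOutside (Within (EdgeMinus G u w) P) S) w t ℓ
      path-unique : Unique (vertices path)

    module _ {p q} (s : path ∋ p ⟶ q) where
      step-edge : Edge G p q
      step-edge = proj₁ (proj₁ (proj₁ (step-rel s)))

      step-not-uw : ¬ SameEdge p q u w
      step-not-uw = proj₂ (proj₁ (proj₁ (step-rel s)))

      step-target∈P : P q
      step-target∈P = proj₂ (proj₂ (proj₁ (step-rel s)))

      step-source∉S : ¬ S p
      step-source∉S = proj₂ (step-rel s)

  Grown : (st : PartialOrientation) → Ear (S st) → Set₁
  Grown st ear = Σ PartialOrientation λ st′ → (∀ {v} → S st v → S st′ v) × S st′ (Ear.w ear)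

  module Extension (st : PartialOrientation) (ear : Ear (S st)) where
    open Ear ear

    EarArc : Fin k → Fin k → Set
    EarArc p q = (p ≡ u × q ≡ w) ⊎ path ∋ p ⟶ q

    S′ : Fin k → Set
    S′ p = S st p ⊎ p ∈ vertices path

    D′ : Fin k → Fin k → Set
    D′ p q = D st p q ⊎ EarArc p q

    private
      earArc? : Decidable EarArc
      earArc? p q = ((p ≟ u) ×-dec (q ≟ w)) ⊎-dec step? path p q

      earArc⊆ : ∀ {p q} → EarArc p q → Within (Edge G) S′ p q
      earArc⊆ (inj₁ (refl , refl)) = proj₁ uw , inj₁ u∈S , inj₂ (source∈ path)
      earArc⊆ (inj₂ s) = step-edge s , inj₂ (proj₁ (step-vertices s)) , inj₂ (proj₂ (step-vertices s))

      earArc-leaves : ∀ {p q} → EarArc p q → ¬ S st p ⊎ ¬ S st q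
      earArc-leaves (inj₁ (refl , refl)) = inj₂ w∉S
      earArc-leaves (inj₂ s)             = inj₁ (step-source∉S s)

      earArc-asym : ∀ {p q} → EarArc p q → EarArc q p → ⊥
      earArc-asym (inj₁ (refl , refl)) (inj₁ (w≡u , _)) = w∉S (subst (S st) (sym w≡u) u∈S)
      earArc-asym (inj₁ (refl , refl)) (inj₂ s) = step-not-uw s (inj₂ (refl , refl))
      earArc-asym (inj₂ s) (inj₁ (refl , refl)) = step-not-uw s (inj₂ (refl , refl))
      earArc-asym (inj₂ s) (inj₂ s′)            = step-asym path-unique s s′

      D-earArc-asym : ∀ {p q} → D st p q → EarArc q p → ⊥
      D-earArc-asym d ea with D⊆ st d
      ... | _ , sp , sq = [ (λ ¬sq → ¬sq sq) , (λ ¬sp → ¬sp sp) ]′ (earArc-leaves ea)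

      D′-asym : ∀ {p q} → D′ p q → D′ q p → ⊥
      D′-asym (inj₁ d)  (inj₁ d′)  = D-asym st d d′
      D′-asym (inj₁ d)  (inj₂ ea)  = D-earArc-asym d ea
      D′-asym (inj₂ ea) (inj₁ d)   = D-earArc-asym d ea
      D′-asym (inj₂ ea) (inj₂ ea′) = earArc-asym ea ea′

      earWalk : Walk EarArc w t ℓ
      earWalk = mapʷ inj₂ (steps path)

      splitEar : ∀ {p} → p ∈ vertices path → Split earWalk p
      splitEar {p} p∈ = split earWalk (subst (p ∈_) (sym (trans (vertices-mapʷ inj₂ (steps path)) (vertices-steps path))) p∈)

      toS : ∀ {p} → S′ p → ∃[ r ] S st r × Reach D′ p r
      toS (inj₁ sp) = _ , sp , 0 , []
      toS (inj₂ p∈) = t , t∈S , reach-map inj₂ (_ , Split.suffix (splitEar p∈))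

      fromS : ∀ {p} → S′ p → ∃[ r ] S st r × Reach D′ r p
      fromS (inj₁ sp) = _ , sp , 0 , []
      fromS (inj₂ p∈) = u , u∈S , reach-map inj₂ (_ , inj₁ (refl , refl) ∷ Split.prefix (splitEar p∈))

      D′-strong : ∀ {p q} → S′ p → S′ q → Reach D′ p q
      D′-strong sp sq with toS sp | fromS sq
      ... | _ , sr , p⇝r | _ , sr′ , r′⇝q =
        reach-trans p⇝r (reach-trans (reach-map inj₁ (D-strong st sr sr′)) r′⇝q)

    extend : (S′ b → Track D′) → Grown st ear
    extend track′ = record
      { S = S′ ; S? = λ p → S? st p ⊎-dec (p ∈? vertices path)
      ; S⊆P = [ S⊆P st , allVertices (proj₂ ∘ proj₂ ∘ proj₁) (proj₂ (proj₂ uw)) path ]′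
      ; a∈S = inj₁ (a∈S st)
      ; D = D′ ; D? = λ p q → D? st p q ⊎-dec earArc? p q
      ; D⊆ = [ (λ d → let e , sp , sq = D⊆ st d in e , inj₁ sp , inj₁ sq) , earArc⊆ ]′
      ; D-asym = D′-asym ; D-strong = D′-strong ; track = track′ }
      , inj₁ , inj₂ (source∈ path)

  outside⇒∉D-walk : (st : PartialOrientation) → ∀ {p q n v} → S st p → ¬ S st v → (W : Walk (D st) p q n) →
                    v ∉ vertices W
  outside⇒∉D-walk st sp v∉S W v∈ = v∉S (allVertices (proj₂ ∘ proj₂ ∘ D⊆ st) sp W v∈)

  alongEar : (st : PartialOrientation) (ear : Ear (S st)) → b ∈ vertices (Ear.path ear) → b ≢ Ear.w ear →
             MissingWalk (Extension.D′ st ear) P b a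
  alongEar st ear b∈path b≢w with stepsFrom path path-unique b∈path b≢w | D-strong st t∈S (a∈S st)
    where open Ear ear
  ... | _ , b⇝t , w∉b⇝t | _ , t⇝a = w , proj₂ (proj₂ uw) , _ ,
      mapʷ (inj₂ ∘ inj₂) b⇝t ++ʷ mapʷ inj₁ t⇝a ,
      ∉-++ʷ (mapʷ _ b⇝t) (mapʷ inj₁ t⇝a) (∉-mapʷ _ b⇝t w∉b⇝t)
            (∉-mapʷ inj₁ t⇝a (outside⇒∉D-walk st t∈S w∉S t⇝a))
    where open Ear ear

  module _ (st : PartialOrientation) (ear : Ear (S st)) where
    open Ear ear

    throughHead : ∀ {q n} → path ∋ w ⟶ q → (W : Walk (D st) a u n) → q ∉ vertices W →
                  MissingWalk (Extension.D′ st ear) P a w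
    throughHead s W q∉ = _ , step-target∈P s , _ , mapʷ inj₁ W ∷ʳ inj₂ (inj₁ (refl , refl)) ,
                         ∉-∷ʳ (mapʷ inj₁ W) _ (∉-mapʷ inj₁ W q∉) (edge-irrefl G (step-edge s) ∘ sym)

    fromHead : ∀ {q n} → path ∋ w ⟶ q → (W : Walk (D st) a q n) → u ∉ vertices W →
               MissingWalk (Extension.D′ (reversePartial st) ear) P w a
    fromHead s W u∉ = u , S⊆P st u∈S , _ , inj₂ (inj₂ s) ∷ reverseʷ inj₁ W ,
                      λ { (here u≡w) → w∉S (subst (S st) u≡w u∈S) ; (there u∈) → ∉-reverseʷ inj₁ W u∉ u∈ }

    extendForward : b ≡ w → MissingWalk (Extension.D′ st ear) P a w → Grown st ear
    extendForward b≡w a⇝w =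
      Extension.extend st ear λ _ → inj₁ (subst (MissingWalk (Extension.D′ st ear) P a) (sym b≡w) a⇝w)

    extendBackward : b ≡ w → MissingWalk (Extension.D′ (reversePartial st) ear) P w a → Grown st ear
    extendBackward b≡w w⇝a = Extension.extend (reversePartial st) ear λ _ →
      inj₂ (subst (λ v → MissingWalk (Extension.D′ (reversePartial st) ear) P v a) (sym b≡w) w⇝a)

    -- With q the ear vertex after w, a walk a ⇝ q in D either passes u first, giving a ⇝ u → w missing q,
    -- or misses u, and then in the reversed D the walk w → q ⇝ a misses u.
    growAtHead : b ≡ w → Grown st ear
    growAtHead b≡w with firstStep path (λ w≡t → w∉S (subst (S st) (sym w≡t) t∈S))
    ... | q , s with S? st q
    ...   | no q∉S =
      extendForward b≡w (throughHead s _ (outside⇒∉D-walk st (a∈S st) q∉S (proj₂ (D-strong st (a∈S st) u∈S))))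
    ...   | yes q∈S
      with firstOf u (λ u≡q → step-not-uw s (inj₂ (refl , sym u≡q))) (proj₂ (D-strong st (a∈S st) q∈S))
    ...     | inj₁ (_ , a⇝u , q∉) = extendForward b≡w (throughHead s a⇝u q∉)
    ...     | inj₂ (_ , a⇝q , u∉) = extendBackward b≡w (fromHead s a⇝q u∉)

  grow : (st : PartialOrientation) (ear : Ear (S st)) → Grown st ear
  grow st ear with S? st b | b ∈? vertices (Ear.path ear) | b ≟ Ear.w ear
  ... | yes b∈S | _          | _       = extend (λ _ → track-map inj₁ (track st b∈S))
    where open Extension st ear
  ... | no b∉S  | no b∉path  | _       = extend [ ⊥-elim ∘ b∉S , ⊥-elim ∘ b∉path ]′
    where open Extension st ear
  ... | no _    | yes b∈path | no b≢w  = extend λ _ → inj₂ (alongEar st ear b∈path b≢w)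
    where open Extension st ear
  ... | no _    | yes _      | yes b≡w = growAtHead st ear b≡w

  earTowards : (st : PartialOrientation) → ∀ {v} → P v → ¬ S st v → Ear (S st)
  earTowards st pv v∉S with exit (S? st) (proj₂ (connected a∈P pv)) (a∈S st) v∉S
  ... | u , w , uw , u∈S , w∉S with firstHit (S? st) (proj₂ (bridgeless uw)) u∈S
  ...   | t , t∈S , _ , W = record
          { uw = uw ; u∈S = u∈S ; w∉S = w∉S ; t∈S = t∈S ; path = path ; path-unique = path-unique }
    where open Shortcut (shortcut W)

  complete : (st : PartialOrientation) → Acc _<_ (k ∸ count (S? st)) →
             Σ PartialOrientation λ st → ∀ {v} → P v → S st v
  complete st (acc rec) with any? (λ v → P? v ×-dec ¬? (S? st v))
  ... | no ∄v = st , λ pv → decidable-stable (S? st _) λ v∉S → ∄v (_ , pv , v∉S)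
  ... | yes (v , pv , v∉S) with grow st (earTowards st pv v∉S)
  ...   | st′ , S⊆S′ , w∈S′ =
    complete st′ (rec (∸-monoʳ-< (count-mono-< (S? st) (S? st′) S⊆S′ _ w∈S′ w∉S) (count≤ (S? st′))))
    where open Ear (earTowards st pv v∉S)

  module _ (st : PartialOrientation) (P⊆S : ∀ {v} → P v → S st v) where

    Chord : Fin k → Fin k → Set
    Chord p q = Within (Edge G) P p q × ¬ D st p q × ¬ D st q p × toℕ p < toℕ q

    orientChords : StrongOrientationOn G P
    orientChords = record
      { _↝_ = λ p q → D st p q ⊎ Chord p q
      ; ↝? = λ p q → D? st p q ⊎-dec ((edge? G p q ×-dec (P? p ×-dec P? q)) ×-dec
                       (¬? (D? st p q) ×-dec (¬? (D? st q p) ×-dec (toℕ p <? toℕ q))))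
      ; ↝⊆edge = [ (λ d → let e , sp , sq = D⊆ st d in e , S⊆P st sp , S⊆P st sq) , proj₁ ]′
      ; ↝-total = total
      ; ↝-asym = asym
      ; ↝-strong = λ pp pq → reach-map inj₁ (D-strong st (P⊆S pp) (P⊆S pq)) }
      where
        total : ∀ {p q} → Within (Edge G) P p q → (D st p q ⊎ Chord p q) ⊎ (D st q p ⊎ Chord q p)
        total {p} {q} (e , pp , pq) with D? st p q | D? st q p | <-cmp (toℕ p) (toℕ q)
        ... | yes d | _     | _           = inj₁ (inj₁ d)
        ... | no _  | yes d | _           = inj₂ (inj₁ d)
        ... | no ¬d | no ¬d′ | tri< p<q _ _ = inj₁ (inj₂ ((e , pp , pq) , ¬d , ¬d′ , p<q))
        ... | no _  | no _   | tri≈ _ p≡q _ = ⊥-elim (edge-irrefl G e (toℕ-injective p≡q))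
        ... | no ¬d | no ¬d′ | tri> _ _ q<p = inj₂ (inj₂ ((edge-sym G e , pq , pp) , ¬d′ , ¬d , q<p))
        asym : ∀ {p q} → D st p q ⊎ Chord p q → D st q p ⊎ Chord q p → ⊥
        asym (inj₁ d) (inj₁ d′)                 = D-asym st d d′
        asym (inj₁ d) (inj₂ (_ , _ , ¬d , _))   = ¬d d
        asym (inj₂ (_ , _ , ¬d , _)) (inj₁ d)   = ¬d d
        asym (inj₂ (_ , _ , _ , p<q)) (inj₂ (_ , _ , _ , q<p)) = <-asym p<q q<p

  strongOrientationWithMissingWalk :
    Σ (StrongOrientationOn G P) λ o → MissingWalk (StrongOrientationOn._↝_ o) P a b
  strongOrientationWithMissingWalk with complete initial (<-wellFounded _)
  ... | st , P⊆S with track st (P⊆S b∈P)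
  ...   | inj₁ a⇝b = orientChords st P⊆S , missingWalk-map inj₁ a⇝b
  ...   | inj₂ b⇝a = reverseOrientation (orientChords st P⊆S) , missingWalk-reverse inj₁ b⇝a

-- Gluing at a cut vertex

module FromRelation {k : ℕ} (G : Graph k) {A : Fin k → Fin k → Set} (A? : Decidable A)
         (A⊆edge : ∀ {p q} → A p q → Edge G p q) (A-total : ∀ {p q} → Edge G p q → A p q ⊎ A q p)
         (A-asym : ∀ {p q} → A p q → A q p → ⊥) where

  orientation : Orientation G
  orientation = record
    { arc    = λ p q → isYes (A? p q)
    ; arc⊆   = λ p q → to T-≡ ∘ A⊆edge ∘ toWitness ∘ from T-≡
    ; covers = λ p q → ⊎-map (to T-≡ ∘ fromWitness) (to T-≡ ∘ fromWitness) ∘ A-total ∘ from T-≡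
    ; oneway = λ p q pq qp → A-asym (toWitness (from T-≡ pq)) (toWitness (from T-≡ qp)) }
    where open Equivalence

  toArc : ∀ {p q} → A p q → Arc orientation p q
  toArc = fromWitness

missing⇒distLe : ∀ {k} {G : Graph k} (o : Orientation G) {x z v n} (W : Walk (Arc o) x z n) → v ∉ vertices W →
                 DistLe o x z (k ∸ 2)
missing⇒distLe o W v∉ = _ , path , path-missing-length≤ path path-unique (v∉ ∘ path-⊆)
  where open Shortcut (shortcut W)

throughCut : ∀ {k} {G : Graph k} (o : Orientation G) {R R′ : Fin k → Fin k → Set} {Q Q′ : Fin k → Set} {c} →
             (∀ {p q} → R p q → Arc o p q) → (∀ {p q} → R′ p q → Arc o p q) →
             (∀ {p q} → R′ p q → Q′ q) → Q′ c → (∀ {v} → Q v → Q′ v → v ≡ c) →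
             ∀ {a b} → MissingWalk R Q a c → Reach R′ c b → DistLe o a b (k ∸ 2)
throughCut o f f′ R′⊆Q′ q′c Q∩Q′ (w , qw , _ , W , w∉W) (_ , V) =
  missing⇒distLe o (mapʷ f W ++ʷ mapʷ f′ V)
                   (∉-++ʷ (mapʷ f W) (mapʷ f′ V) (∉-mapʷ f W w∉W) (∉-mapʷ f′ V w∉V))
  where
    w∉V : _ ∉ vertices V
    w∉V w∈V = w∉W (subst (_∈ vertices W) (sym (Q∩Q′ qw (allVertices R′⊆Q′ q′c V w∈V))) (target∈ W))

module _ {k : ℕ} (G : Graph k) where

  detour : (∀ u v → ¬ IsBridge G u v) → ∀ {u w} → Edge G u w → Reach (EdgeMinus G u w) w u
  detour no-bridge {u} {w} e with reach? edgeMinus? w u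
    where
      edgeMinus? : Decidable (EdgeMinus G u w)
      edgeMinus? p q = edge? G p q ×-dec ¬? (((p ≟ u) ×-dec (q ≟ w)) ⊎-dec ((p ≟ w) ×-dec (q ≟ u)))
  ... | yes w⇝u = w⇝u
  ... | no ¬w⇝u = ⊥-elim (no-bridge u w (e , λ connected → ¬w⇝u (connected w u)))

  Attached : (Fin k → Set) → Fin k → Set
  Attached P c = ∀ {p q} → Edge G p q → P p → ¬ P q → p ≡ c

  module _ {P : Fin k → Set} (P? : ∀ v → Dec (P v)) {c : Fin k} (attached : Attached P c) where

    private
      lastEntry : ∀ {R q r m} → Walk (LeavingOutside R P) q r m → ¬ P q → P r → ∃[ s ] R s r × ¬ P s
      lastEntry []                    ¬pq pr = ⊥-elim (¬pq pr)
      lastEntry ((e , ¬ps) ∷ [])      _   _  = _ , e , ¬ps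
      lastEntry (_ ∷ (f ∷ W))         _   pr = lastEntry (f ∷ W) (proj₂ f) pr

      excursions-return : ∀ {R} → (∀ {p q} → R p q → Edge G p q) → ExcursionsReturn R P
      excursions-return toE e pp ¬pq W pr with lastEntry W ¬pq pr
      ... | _ , e′ , ¬ps = trans (attached (toE e) pp ¬pq) (sym (attached (edge-sym G (toE e′)) pr ¬ps))

    attached-connected : Connected G → ∀ {u v} → P u → P v → Reach (Within (Edge G) P) u v
    attached-connected conn {u} {v} = stayWithin P? (excursions-return id) (proj₂ (conn u v))

    attached-bridgeless : (∀ u v → ¬ IsBridge G u v) →
                          ∀ {u w} → Within (Edge G) P u w → Reach (Within (EdgeMinus G u w) P) w u
    attached-bridgeless no-bridge (e , pu , pw) =
      stayWithin P? (excursions-return proj₁) (proj₂ (detour no-bridge e)) pw pu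

module Glue {k : ℕ} (G : Graph k) {Q₁ Q₂ : Fin k → Set} (Q₂? : ∀ v → Dec (Q₂ v)) {c : Fin k}
            (Q₁∩Q₂ : ∀ {v} → Q₁ v → Q₂ v → v ≡ c) (Q₁∪Q₂ : ∀ {v} → ¬ Q₂ v → Q₁ v)
            (split-edge : ∀ {p q} → Edge G p q → ¬ (Q₂ p × Q₂ q) → Q₁ p × Q₁ q)
            (c∈Q₁ : Q₁ c) (c∈Q₂ : Q₂ c)
            (o₁ : StrongOrientationOn G Q₁) (o₂ : StrongOrientationOn G Q₂) where

  private
    module O₁ = StrongOrientationOn o₁
    module O₂ = StrongOrientationOn o₂

    Arcs : Fin k → Fin k → Set
    Arcs p q = (Q₂ p × Q₂ q × p O₂.↝ q) ⊎ (¬ (Q₂ p × Q₂ q) × p O₁.↝ q)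

    arcs? : Decidable Arcs
    arcs? p q = (Q₂? p ×-dec (Q₂? q ×-dec O₂.↝? p q)) ⊎-dec (¬? (Q₂? p ×-dec Q₂? q) ×-dec O₁.↝? p q)

    arcs⊆edge : ∀ {p q} → Arcs p q → Edge G p q
    arcs⊆edge = [ proj₁ ∘ O₂.↝⊆edge ∘ proj₂ ∘ proj₂ , proj₁ ∘ O₁.↝⊆edge ∘ proj₂ ]′

    arcs₁ : ∀ {p q} → p O₁.↝ q → Arcs p q
    arcs₁ a with O₁.↝⊆edge a
    ... | e , p∈Q₁ , q∈Q₁ =
      inj₂ ((λ (p∈Q₂ , q∈Q₂) → edge-irrefl G e (trans (Q₁∩Q₂ p∈Q₁ p∈Q₂) (sym (Q₁∩Q₂ q∈Q₁ q∈Q₂)))) , a)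

    arcs₂ : ∀ {p q} → p O₂.↝ q → Arcs p q
    arcs₂ a = inj₁ (proj₁ (proj₂ (O₂.↝⊆edge a)) , proj₂ (proj₂ (O₂.↝⊆edge a)) , a)

    arcs-total : ∀ {p q} → Edge G p q → Arcs p q ⊎ Arcs q p
    arcs-total {p} {q} e with Q₂? p ×-dec Q₂? q
    ... | yes (p∈Q₂ , q∈Q₂) = ⊎-map arcs₂ arcs₂ (O₂.↝-total (e , p∈Q₂ , q∈Q₂))
    ... | no ¬both          = ⊎-map arcs₁ arcs₁ (O₁.↝-total (e , split-edge e ¬both))

    arcs-asym : ∀ {p q} → Arcs p q → Arcs q p → ⊥
    arcs-asym (inj₁ (_ , _ , a))   (inj₁ (_ , _ , a′))  = O₂.↝-asym a a′
    arcs-asym (inj₂ (_ , a))       (inj₂ (_ , a′))      = O₁.↝-asym a a′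
    arcs-asym (inj₁ (pq₂ , qq₂ , _)) (inj₂ (¬both , _)) = ¬both (qq₂ , pq₂)
    arcs-asym (inj₂ (¬both , _)) (inj₁ (qq₂ , pq₂ , _)) = ¬both (pq₂ , qq₂)

    module O = FromRelation G arcs? arcs⊆edge arcs-total arcs-asym

  orientation : Orientation G
  orientation = O.orientation

  from₁ : ∀ {p q} → p O₁.↝ q → Arc orientation p q
  from₁ = O.toArc ∘ arcs₁

  from₂ : ∀ {p q} → p O₂.↝ q → Arc orientation p q
  from₂ = O.toArc ∘ arcs₂

  strong : Strong orientation
  strong u v = reach-trans (toC u) (fromC v)
    where
      toC : ∀ u → Reach (Arc orientation) u c
      toC u with Q₂? u
      ... | yes u∈Q₂ = reach-map from₂ (O₂.↝-strong u∈Q₂ c∈Q₂)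
      ... | no u∉Q₂  = reach-map from₁ (O₁.↝-strong (Q₁∪Q₂ u∉Q₂) c∈Q₁)
      fromC : ∀ v → Reach (Arc orientation) c v
      fromC v with Q₂? v
      ... | yes v∈Q₂ = reach-map from₂ (O₂.↝-strong c∈Q₂ v∈Q₂)
      ... | no v∉Q₂  = reach-map from₁ (O₁.↝-strong c∈Q₁ (Q₁∪Q₂ v∉Q₂))

module Separated {k : ℕ} (G : Graph k) (bridgeless : Bridgeless G) {x z c : Fin k}
                 (c≢x : c ≢ x) (c≢z : c ≢ z) (x↛z : ¬ Reach (Avoiding G c) x z) where

  ZComponent : Fin k → Set
  ZComponent = Reach (Avoiding G c) z

  XSide ZSide : Fin k → Set
  XSide v = ¬ ZComponent v
  ZSide v = v ≡ c ⊎ ZComponent v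

  private
    inZ? : ∀ v → Dec (ZComponent v)
    inZ? = reach? (avoiding? G c) z

    ZComponent≢c : ∀ {v} → ZComponent v → v ≢ c
    ZComponent≢c (_ , W) = last≢ W (c≢z ∘ sym)
      where
        last≢ : ∀ {p q n} → Walk (Avoiding G c) p q n → p ≢ c → q ≢ c
        last≢ []              p≢c = p≢c
        last≢ ((_ , _ , q≢c) ∷ W) _ = last≢ W q≢c

    ZComponent-step : ∀ {p q} → ZComponent p → Edge G p q → q ≢ c → ZComponent q
    ZComponent-step zp e q≢c = _ , proj₂ zp ∷ʳ (e , ZComponent≢c zp , q≢c)

    ZSide-step : ∀ {p q} → ZComponent p → Edge G p q → ZSide q
    ZSide-step {q = q} zp e with q ≟ c
    ... | yes q≡c = inj₁ q≡c
    ... | no q≢c  = inj₂ (ZComponent-step zp e q≢c)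

    XSide∩ZSide : ∀ {v} → XSide v → ZSide v → v ≡ c
    XSide∩ZSide _  (inj₁ v≡c) = v≡c
    XSide∩ZSide ¬z (inj₂ z)   = ⊥-elim (¬z z)

    x∈X : XSide x
    x∈X = x↛z ∘ reach-reverse (avoiding-sym G)

    c∈X : XSide c
    c∈X zc = ZComponent≢c zc refl

    split-edge : ∀ {p q} → Edge G p q → ¬ (ZSide p × ZSide q) → XSide p × XSide q
    split-edge e ¬both = (λ zp → ¬both (inj₂ zp , ZSide-step zp e))
                       , (λ zq → ¬both (ZSide-step zq (edge-sym G e) , inj₂ zq))

    X-attached : Attached G XSide c
    X-attached {p} e ¬zp zq with p ≟ c
    ... | yes p≡c = p≡c
    ... | no p≢c  = ⊥-elim (¬zp (ZComponent-step (decidable-stable (inZ? _) zq) (edge-sym G e) p≢c))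

    Z-attached : Attached G ZSide c
    Z-attached e (inj₁ p≡c) _   = p≡c
    Z-attached e (inj₂ zp)  ¬zq = ⊥-elim (¬zq (ZSide-step zp e))

    inX? : ∀ v → Dec (XSide v)
    inX? = ¬? ∘ inZ?

    inZSide? : ∀ v → Dec (ZSide v)
    inZSide? v = (v ≟ c) ⊎-dec inZ? v

    module X = EarDecomposition G inX? (attached-connected G inX? X-attached (proj₁ bridgeless))
                 (attached-bridgeless G inX? X-attached (proj₂ bridgeless)) x∈X c∈X (c≢x ∘ sym)
    module Z = EarDecomposition G inZSide? (attached-connected G inZSide? Z-attached (proj₁ bridgeless))
                 (attached-bridgeless G inZSide? Z-attached (proj₂ bridgeless))
                 (inj₂ (0 , [])) (inj₁ refl) (c≢z ∘ sym)
    open X using () renaming (strongOrientationWithMissingWalk to sideX)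
    open Z using () renaming (strongOrientationWithMissingWalk to sideZ)
    module OX = StrongOrientationOn (proj₁ sideX)
    module OZ = StrongOrientationOn (proj₁ sideZ)
    module Glued = Glue G inZSide? XSide∩ZSide (λ ¬zv zv → ¬zv (inj₂ zv)) split-edge c∈X (inj₁ refl)
                        (proj₁ sideX) (proj₁ sideZ)

  orientation : Σ (Orientation G) λ o → Strong o × DistLe o x z (k ∸ 2) × DistLe o z x (k ∸ 2)
  orientation = Glued.orientation , Glued.strong
    , throughCut Glued.orientation Glued.from₁ Glued.from₂ (proj₂ ∘ proj₂ ∘ OZ.↝⊆edge) (inj₁ refl) XSide∩ZSide
                 (proj₂ sideX) (OZ.↝-strong (inj₁ refl) (inj₂ (0 , [])))
    , throughCut Glued.orientation Glued.from₂ Glued.from₁ (proj₂ ∘ proj₂ ∘ OX.↝⊆edge) c∈X (flip XSide∩ZSide)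
                 (proj₂ sideZ) (OX.↝-strong c∈X x∈X)

lemma1 : (k : ℕ) (G : Graph k) → Bridgeless G →
    (x z : Fin k) → ¬ InCommonBlock G x z →
    Σ (Orientation G) λ o → Strong o × DistLe o x z (k ∸ 2) × DistLe o z x (k ∸ 2)
lemma1 k G bridgeless x z ¬common
  with separator G (¬common ∘ inseparable⇒inCommonBlock G (proj₁ bridgeless))
... | c , c≢x , c≢z , x↛z = Separated.orientation G bridgeless c≢x c≢z x↛z
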